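{- For $n\ge1$, the number of inversion sequences $e\in\mathbf{I}_n$ with no index $i$ such that $e_i\neq e_{i+1}=e_{i+2}$ equals $\sum_{i=0}^{n-1}\frac{(n-1)!}{i!}$.
   Context: An inversion sequence of length $n$ is an integer sequence $e=e_1\dots e_n$ with $0\le e_i<i$ for all $i$; $\mathbf{I}_n$ is the set of these. (In the paper's notation this is $|\mathbf{I}_n(\underline{\neq,=})|$.) -}

module Defs where

open import Data.Nat using (ℕ; zero; suc; _+_; _∸_; _<_; _/_; _!; _≟_)
open import Data.Nat.Properties using (_!≢0)
open import Data.List using (List; []; _∷_; length; filter; map; concatMap; upTo; _∷ʳ_)
open import Data.Bool using (Bool; true; false; _∧_; not)
open import Relation.Nullary.Decidable using (⌊_⌋)

-- Inversion sequences e = e_1 … e_n are represented as lists [e_1, …, e_n] of naturals.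
-- invSeqs n enumerates I_n: all lists of length n with 0 ≤ e_i < i (1-indexed),
-- built by appending every admissible last entry e_n ∈ {0,…,n-1}.
invSeqs : ℕ → List (List ℕ)
invSeqs zero    = [] ∷ []
invSeqs (suc n) = concatMap (λ e → map (λ x → e ∷ʳ x) (upTo (suc n))) (invSeqs n)

hasPattern : List ℕ → Bool
hasPattern (a ∷ b ∷ c ∷ rest) =
  (not ⌊ a ≟ b ⌋ ∧ ⌊ b ≟ c ⌋) Data.Bool.∨ hasPattern (b ∷ c ∷ rest)
hasPattern _ = false

countAvoiding : ℕ → ℕ
countAvoiding n = length (filter (λ e → not (hasPattern e) Data.Bool.≟ true) (invSeqs n))

sumBelow : ℕ → (ℕ → ℕ) → ℕ
sumBelow zero    f = 0
sumBelow (suc m) f = sumBelow m f + f m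

-- Σ_{i=0}^{n-1} (n-1)!/i!   (each quotient is exact since i ≤ n-1)
target : ℕ → ℕ
target n = sumBelow n (λ i → _/_ ((n ∸ 1) !) (i !) {{i !≢0}})

module Submission where

-- Reading a sequence from left to right, avoidance of the pattern
-- e_i ≠ e_{i+1} = e_{i+2} is decided by a four-phase automaton: the sequence is
-- either still constant, or has changed value and since then never repeated an
-- entry (only its last entry matters), or has already failed.  An inversion
-- sequence of length n+1 is an e ∈ I_n followed by some x ≤ n; if e is constant
-- (it is then 0…0) all n+1 extensions avoid the pattern and exactly one of them
-- stays constant, while if e has changed with last entry l < n, exactly the n
-- extensions with x ≠ l avoid it.  Writing G n and C n for the numbers of
-- avoiding and of constant sequences in I_n this gives
--     G (n+1) = n · G n + C n   and   C n = 1,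
-- the recurrence satisfied by  Σ_{i<n} (n-1)!/i!.

open import Defs
open import Data.Nat using (ℕ; _≥_; zero; suc; _+_; _*_; _<_; _≤_; _/_; _!; _≟_)
open import Data.Nat.Properties
  using (_!≢0; +-identityʳ; +-comm; +-assoc; +-cancelˡ-≡; *-zeroʳ; *-identityʳ; *-distribˡ-+;
         ≤-refl; ≤-pred; <⇒≤; <-irrefl; m<n⇒m<1+n; m≤n⇒m<n∨m≡n)
open import Data.Nat.DivMod using (*-/-assoc; n/n≡1)
open import Data.Nat.Divisibility using (m≤n⇒m!∣n!)
open import Data.Nat.ListAction using (sum)
open import Data.Nat.ListAction.Properties using (sum-++)
open import Data.List using (List; []; _∷_; length; filter; map; concatMap; upTo; _∷ʳ_; foldl; _++_)
open import Data.List.Properties using (map-++; map-cong; map-cong-local; map-∘; foldl-∷ʳ; upTo-∷ʳ; length-upTo)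
open import Data.List.Relation.Unary.All using (All; []; _∷_)
import Data.List.Relation.Unary.All as All
open import Data.List.Relation.Unary.All.Properties using (concat⁺; map⁺; applyUpTo⁺₁)
open import Data.Bool using (Bool; true; false; not; _∨_)
import Data.Bool
open import Data.Unit using (⊤; tt)
open import Data.Empty using (⊥-elim)
open import Data.Sum using (inj₁; inj₂)
open import Relation.Nullary using (yes; no; ¬_)
open import Relation.Nullary.Decidable using (⌊_⌋)
open import Relation.Binary.PropositionalEquality using (_≡_; refl; sym; trans; cong; cong₂; subst; module ≡-Reasoning)
open import Function using (_∘_)

data Phase : Set where
  empty    : Phase
  constant : ℕ → Phase
  changed  : ℕ → Phase    -- not constant, no pattern yet, last two entries differ; last entry given
  failed   : Phase

advance : Phase → ℕ → Phase
advance empty        x = constant x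
advance (constant a) x with a ≟ x
... | yes _ = constant a
... | no  _ = changed x
advance (changed l)  x with l ≟ x
... | yes _ = failed
... | no  _ = changed x
advance failed       x = failed

phase : List ℕ → Phase
phase = foldl advance empty

avoids : Phase → Bool
avoids failed = false
avoids _      = true

isConstant : Phase → Bool
isConstant empty        = true
isConstant (constant _) = true
isConstant _            = false

equals : ℕ → ℕ → Bool
equals l x = ⌊ l ≟ x ⌋

hasPattern-repeat : ∀ a ys → hasPattern (a ∷ a ∷ ys) ≡ hasPattern (a ∷ ys)
hasPattern-repeat a []       = refl
hasPattern-repeat a (c ∷ ys) with a ≟ a
... | yes _   = refl
... | no a≢a = ⊥-elim (a≢a refl)

hasPattern-after-change : ∀ {p l} x ys → ¬ p ≡ l →
  hasPattern (p ∷ l ∷ x ∷ ys) ≡ equals l x ∨ hasPattern (l ∷ x ∷ ys)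
hasPattern-after-change {p} {l} x ys p≢l with p ≟ l
... | yes p≡l = ⊥-elim (p≢l p≡l)
... | no  _   = refl

failed-absorbs : ∀ xs → foldl advance failed xs ≡ failed
failed-absorbs []       = refl
failed-absorbs (_ ∷ xs) = failed-absorbs xs

changed-correct : ∀ p l xs → ¬ p ≡ l →
  avoids (foldl advance (changed l) xs) ≡ not (hasPattern (p ∷ l ∷ xs))
changed-correct p l []       _   = refl
changed-correct p l (x ∷ xs) p≢l
  rewrite hasPattern-after-change x xs p≢l with l ≟ x
... | yes _   = cong avoids (failed-absorbs xs)
... | no  l≢x = changed-correct l x xs l≢x

constant-correct : ∀ a xs → avoids (foldl advance (constant a) xs) ≡ not (hasPattern (a ∷ xs))
constant-correct a []       = refl
constant-correct a (x ∷ xs) with a ≟ x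
... | yes refl = trans (constant-correct a xs) (cong not (sym (hasPattern-repeat a xs)))
... | no  a≢x  = changed-correct a x xs a≢x

phase-correct : ∀ xs → avoids (phase xs) ≡ not (hasPattern xs)
phase-correct []       = refl
phase-correct (x ∷ xs) = constant-correct x xs

phase-∷ʳ : ∀ e x → phase (e ∷ʳ x) ≡ advance (phase e) x
phase-∷ʳ e x = foldl-∷ʳ advance empty x e

indicator : Bool → ℕ
indicator true  = 1
indicator false = 0

count : {A : Set} → (A → Bool) → List A → ℕ
count p xs = sum (map (indicator ∘ p) xs)

count-filter : {A : Set} (p : A → Bool) (xs : List A) → length (filter (λ x → p x Data.Bool.≟ true) xs) ≡ count p xs
count-filter p []       = refl
count-filter p (x ∷ xs) with p x
... | true  = cong suc (count-filter p xs)
... | false = count-filter p xs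

count-++ : {A : Set} (p : A → Bool) (xs ys : List A) → count p (xs ++ ys) ≡ count p xs + count p ys
count-++ p xs ys = trans (cong sum (map-++ (indicator ∘ p) xs ys)) (sum-++ (map (indicator ∘ p) xs) _)

count-concatMap : {A B : Set} (p : B → Bool) (g : A → List B) (xs : List A) →
  count p (concatMap g xs) ≡ sum (map (count p ∘ g) xs)
count-concatMap p g []       = refl
count-concatMap p g (x ∷ xs) = trans (count-++ p (g x) (concatMap g xs)) (cong (count p (g x) +_) (count-concatMap p g xs))

count-map : {A B : Set} (p : B → Bool) (f : A → B) (xs : List A) → count p (map f xs) ≡ count (p ∘ f) xs
count-map p f xs = cong sum (sym (map-∘ xs))

count-cong : {A : Set} {p q : A → Bool} → (∀ x → p x ≡ q x) → ∀ xs → count p xs ≡ count q xs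
count-cong p≗q xs = cong sum (map-cong (cong indicator ∘ p≗q) xs)

count-complement : {A : Set} (p : A → Bool) (xs : List A) → count (not ∘ p) xs + count p xs ≡ length xs
count-complement p []       = refl
count-complement p (x ∷ xs) with p x
... | true  = trans (+-comm (count (not ∘ p) xs) (suc (count p xs)))
                    (cong suc (trans (+-comm (count p xs) _) (count-complement p xs)))
... | false = cong suc (count-complement p xs)

count-true : {A : Set} (xs : List A) → count (λ _ → true) xs ≡ length xs
count-true []       = refl
count-true (_ ∷ xs) = cong suc (count-true xs)

count-false : {A : Set} (xs : List A) → count (λ _ → false) xs ≡ 0
count-false []       = refl
count-false (_ ∷ xs) = count-false xs

count-upTo-suc : (p : ℕ → Bool) (m : ℕ) → count p (upTo (suc m)) ≡ count p (upTo m) + indicator (p m)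
count-upTo-suc p m = begin
  count p (upTo (suc m))               ≡⟨ cong (count p) (sym (upTo-∷ʳ m)) ⟩
  count p (upTo m ++ m ∷ [])           ≡⟨ count-++ p (upTo m) (m ∷ []) ⟩
  count p (upTo m) + (indicator (p m) + 0) ≡⟨ cong (count p (upTo m) +_) (+-identityʳ _) ⟩
  count p (upTo m) + indicator (p m)   ∎
  where open ≡-Reasoning

indicator-equals-≢ : ∀ {l x} → ¬ l ≡ x → indicator (equals l x) ≡ 0
indicator-equals-≢ {l} {x} l≢x with l ≟ x
... | yes l≡x = ⊥-elim (l≢x l≡x)
... | no  _   = refl

indicator-equals-refl : ∀ l → indicator (equals l l) ≡ 1
indicator-equals-refl l with l ≟ l
... | yes _   = refl
... | no  l≢l = ⊥-elim (l≢l refl)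

count-equals-absent : ∀ l m → m ≤ l → count (equals l) (upTo m) ≡ 0
count-equals-absent l zero    _   = refl
count-equals-absent l (suc m) m<l = trans (count-upTo-suc (equals l) m)
  (cong₂ _+_ (count-equals-absent l m (<⇒≤ m<l)) (indicator-equals-≢ (λ l≡m → <-irrefl (sym l≡m) m<l)))

count-equals-present : ∀ l m → l < m → count (equals l) (upTo m) ≡ 1
count-equals-present l (suc m) l<1+m with m≤n⇒m<n∨m≡n (≤-pred l<1+m)
... | inj₁ l<m  = trans (count-upTo-suc (equals l) m)
  (cong₂ _+_ (count-equals-present l m l<m) (indicator-equals-≢ (λ l≡m → <-irrefl l≡m l<m)))
... | inj₂ refl = trans (count-upTo-suc (equals l) l)
  (cong₂ _+_ (count-equals-absent l l ≤-refl) (indicator-equals-refl l))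

count-differs : ∀ l n → l < suc n → count (not ∘ equals l) (upTo (suc n)) ≡ n
count-differs l n l<1+n = +-cancelˡ-≡ 1 _ _ (begin
  1 + count (not ∘ equals l) (upTo (suc n))   ≡⟨ cong (_+ count (not ∘ equals l) (upTo (suc n))) (sym (count-equals-present l (suc n) l<1+n)) ⟩
  count (equals l) (upTo (suc n)) + count (not ∘ equals l) (upTo (suc n))
    ≡⟨ +-comm (count (equals l) (upTo (suc n))) _ ⟩
  count (not ∘ equals l) (upTo (suc n)) + count (equals l) (upTo (suc n))
    ≡⟨ count-complement (equals l) (upTo (suc n)) ⟩
  length (upTo (suc n))                         ≡⟨ length-upTo (suc n) ⟩
  1 + n                                         ∎)
  where open ≡-Reasoning

-- Phases that can occur after reading an element of I_n: every entry read is
-- below n, and the empty phase occurs only for n = 0.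
Reachable : ℕ → Phase → Set
Reachable n empty        = n ≡ 0
Reachable n (constant a) = a < n
Reachable n (changed l)  = l < n
Reachable n failed       = ⊤

advance-reachable : ∀ n s x → Reachable n s → x < suc n → Reachable (suc n) (advance s x)
advance-reachable n empty        x _   x<1+n = x<1+n
advance-reachable n (constant a) x a<n x<1+n with a ≟ x
... | yes _ = m<n⇒m<1+n a<n
... | no  _ = x<1+n
advance-reachable n (changed l)  x _   x<1+n with l ≟ x
... | yes _ = tt
... | no  _ = x<1+n
advance-reachable n failed       x _   _     = tt

phases-reachable : ∀ n → All (Reachable n ∘ phase) (invSeqs n)
phases-reachable zero    = refl ∷ []
phases-reachable (suc n) = concat⁺ (map⁺ (All.map extensions-reachable (phases-reachable n)))
  where
  extensions-reachable : ∀ {e} → Reachable n (phase e) →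
    All (Reachable (suc n) ∘ phase) (map (e ∷ʳ_) (upTo (suc n)))
  extensions-reachable {e} r = map⁺ (applyUpTo⁺₁ (λ x → x) (suc n) λ {x} x<1+n →
    subst (Reachable (suc n)) (sym (phase-∷ʳ e x)) (advance-reachable n (phase e) x r x<1+n))

constant-advance-avoids : ∀ a x → avoids (advance (constant a) x) ≡ true
constant-advance-avoids a x with a ≟ x
... | yes _ = refl
... | no  _ = refl

constant-advance-constant : ∀ a x → isConstant (advance (constant a) x) ≡ equals a x
constant-advance-constant a x with a ≟ x
... | yes _ = refl
... | no  _ = refl

changed-advance-avoids : ∀ l x → avoids (advance (changed l) x) ≡ not (equals l x)
changed-advance-avoids l x with l ≟ x
... | yes _ = refl
... | no  _ = refl

changed-advance-constant : ∀ l x → isConstant (advance (changed l) x) ≡ false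
changed-advance-constant l x with l ≟ x
... | yes _ = refl
... | no  _ = refl

avoiding-extensions : ∀ n s → Reachable n s →
  count (avoids ∘ advance s) (upTo (suc n)) ≡ n * indicator (avoids s) + indicator (isConstant s)
avoiding-extensions n empty        refl = refl
avoiding-extensions n (constant a) _    = begin
  count (avoids ∘ advance (constant a)) (upTo (suc n)) ≡⟨ count-cong (constant-advance-avoids a) (upTo (suc n)) ⟩
  count (λ _ → true) (upTo (suc n))                    ≡⟨ count-true (upTo (suc n)) ⟩
  length (upTo (suc n))                                ≡⟨ length-upTo (suc n) ⟩
  1 + n                                                ≡⟨ +-comm 1 n ⟩
  n + 1                                                ≡⟨ cong (_+ 1) (sym (*-identityʳ n)) ⟩
  n * 1 + 1                                            ∎
  where open ≡-Reasoning
avoiding-extensions n (changed l)  l<n  = begin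
  count (avoids ∘ advance (changed l)) (upTo (suc n))  ≡⟨ count-cong (changed-advance-avoids l) (upTo (suc n)) ⟩
  count (not ∘ equals l) (upTo (suc n))                ≡⟨ count-differs l n (m<n⇒m<1+n l<n) ⟩
  n                                                    ≡⟨ sym (trans (+-identityʳ (n * 1)) (*-identityʳ n)) ⟩
  n * 1 + 0                                            ∎
  where open ≡-Reasoning
avoiding-extensions n failed       _    =
  trans (count-false (upTo (suc n))) (sym (trans (+-identityʳ (n * 0)) (*-zeroʳ n)))

constant-extensions : ∀ n s → Reachable n s →
  count (isConstant ∘ advance s) (upTo (suc n)) ≡ indicator (isConstant s)
constant-extensions n empty        refl = refl
constant-extensions n (constant a) a<n  =
  trans (count-cong (constant-advance-constant a) (upTo (suc n))) (count-equals-present a (suc n) (m<n⇒m<1+n a<n))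
constant-extensions n (changed l)  _    =
  trans (count-cong (changed-advance-constant l) (upTo (suc n))) (count-false (upTo (suc n)))
constant-extensions n failed       _    = count-false (upTo (suc n))

count-by-prefix : ∀ (p : Phase → Bool) n →
  count (p ∘ phase) (invSeqs (suc n)) ≡ sum (map (λ e → count (p ∘ advance (phase e)) (upTo (suc n))) (invSeqs n))
count-by-prefix p n = trans (count-concatMap (p ∘ phase) _ (invSeqs n)) (cong sum (map-cong extensions (invSeqs n)))
  where
  extensions : ∀ e → count (p ∘ phase) (map (e ∷ʳ_) (upTo (suc n))) ≡ count (p ∘ advance (phase e)) (upTo (suc n))
  extensions e = trans (count-map (p ∘ phase) (e ∷ʳ_) (upTo (suc n)))
                       (count-cong (λ x → cong p (phase-∷ʳ e x)) (upTo (suc n)))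

count-affine : {A : Set} (n : ℕ) (f g : A → Bool) (xs : List A) →
  sum (map (λ x → n * indicator (f x) + indicator (g x)) xs) ≡ n * count f xs + count g xs
count-affine n f g []       = sym (trans (+-identityʳ (n * 0)) (*-zeroʳ n))
count-affine n f g (x ∷ xs) = begin
  (n * a + b) + sum (map (λ x → n * indicator (f x) + indicator (g x)) xs) ≡⟨ cong ((n * a + b) +_) (count-affine n f g xs) ⟩
  (n * a + b) + (n * s + t)   ≡⟨ +-assoc (n * a) b (n * s + t) ⟩
  n * a + (b + (n * s + t))   ≡⟨ cong (n * a +_) (trans (sym (+-assoc b (n * s) t)) (cong (_+ t) (+-comm b (n * s)))) ⟩
  n * a + ((n * s + b) + t)   ≡⟨ cong (n * a +_) (+-assoc (n * s) b t) ⟩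
  n * a + (n * s + (b + t))   ≡⟨ sym (+-assoc (n * a) (n * s) (b + t)) ⟩
  (n * a + n * s) + (b + t)   ≡⟨ cong (_+ (b + t)) (sym (*-distribˡ-+ n a s)) ⟩
  n * (a + s) + (b + t)       ∎
  where
  open ≡-Reasoning
  a = indicator (f x)
  b = indicator (g x)
  s = count f xs
  t = count g xs

avoiders : ℕ → ℕ
avoiders n = count (avoids ∘ phase) (invSeqs n)

constants : ℕ → ℕ
constants n = count (isConstant ∘ phase) (invSeqs n)

avoiders-suc : ∀ n → avoiders (suc n) ≡ n * avoiders n + constants n
avoiders-suc n = begin
  avoiders (suc n)
    ≡⟨ count-by-prefix avoids n ⟩
  sum (map (λ e → count (avoids ∘ advance (phase e)) (upTo (suc n))) (invSeqs n))
    ≡⟨ cong sum (map-cong-local (All.map (λ {e} → avoiding-extensions n (phase e)) (phases-reachable n))) ⟩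
  sum (map (λ e → n * indicator (avoids (phase e)) + indicator (isConstant (phase e))) (invSeqs n))
    ≡⟨ count-affine n (avoids ∘ phase) (isConstant ∘ phase) (invSeqs n) ⟩
  n * avoiders n + constants n ∎
  where open ≡-Reasoning

-- Only the all-zero sequence is constant.
constants-one : ∀ n → constants n ≡ 1
constants-one zero    = refl
constants-one (suc n) = begin
  constants (suc n)
    ≡⟨ count-by-prefix isConstant n ⟩
  sum (map (λ e → count (isConstant ∘ advance (phase e)) (upTo (suc n))) (invSeqs n))
    ≡⟨ cong sum (map-cong-local (All.map (λ {e} → constant-extensions n (phase e)) (phases-reachable n))) ⟩
  constants n
    ≡⟨ constants-one n ⟩
  1 ∎
  where open ≡-Reasoning

countAvoiding-avoiders : ∀ n → countAvoiding n ≡ avoiders n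
countAvoiding-avoiders n = trans (count-filter (not ∘ hasPattern) (invSeqs n))
                                 (count-cong (λ e → sym (phase-correct e)) (invSeqs n))

sumBelow-cong : ∀ k (f g : ℕ → ℕ) → (∀ i → i < k → f i ≡ g i) → sumBelow k f ≡ sumBelow k g
sumBelow-cong zero    f g _    = refl
sumBelow-cong (suc k) f g f≗g = cong₂ _+_ (sumBelow-cong k f g (λ i i<k → f≗g i (m<n⇒m<1+n i<k))) (f≗g k ≤-refl)

sumBelow-scale : ∀ k c (f : ℕ → ℕ) → sumBelow k (λ i → c * f i) ≡ c * sumBelow k f
sumBelow-scale zero    c f = sym (*-zeroʳ c)
sumBelow-scale (suc k) c f = trans (cong (_+ c * f k) (sumBelow-scale k c f)) (sym (*-distribˡ-+ c (sumBelow k f) (f k)))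

-- (m+1)!/i! = (m+1) · m!/i! for i ≤ m, since i! divides m!.
factorial-quotient-suc : ∀ m i → i ≤ m → _/_ (suc m !) (i !) {{i !≢0}} ≡ suc m * _/_ (m !) (i !) {{i !≢0}}
factorial-quotient-suc m i i≤m = *-/-assoc (suc m) {{i !≢0}} (m≤n⇒m!∣n! i≤m)

-- The closed form satisfies the same recurrence:
--   Σ_{i≤m+1} (m+1)!/i! = (m+1) · Σ_{i≤m} m!/i! + (m+1)!/(m+1)!.
target-suc : ∀ m → target (suc (suc m)) ≡ suc m * target (suc m) + 1
target-suc m = cong₂ _+_
  (trans (sumBelow-cong (suc m) _ _ (λ i i<1+m → factorial-quotient-suc m i (≤-pred i<1+m)))
         (sumBelow-scale (suc m) (suc m) (λ i → _/_ (m !) (i !) {{i !≢0}})))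
  (n/n≡1 (suc m !) {{suc m !≢0}})

avoiders-target : ∀ m → avoiders (suc m) ≡ target (suc m)
avoiders-target zero    = refl
avoiders-target (suc m) = begin
  avoiders (suc (suc m))                       ≡⟨ avoiders-suc (suc m) ⟩
  suc m * avoiders (suc m) + constants (suc m) ≡⟨ cong₂ _+_ (cong (suc m *_) (avoiders-target m)) (constants-one (suc m)) ⟩
  suc m * target (suc m) + 1                   ≡⟨ sym (target-suc m) ⟩
  target (suc (suc m))                         ∎
  where open ≡-Reasoning

proposition4p26 : (n : ℕ) → n ≥ 1 → countAvoiding n ≡ target n
proposition4p26 (suc m) _ = trans (countAvoiding-avoiders (suc m)) (avoiders-target m)
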